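{- Let $G$ be a finite simple graph with minimum degree $\delta$ and maximum degree $\Delta$, independence number $\alpha(G)$ and matching number $\mu(G)$. Then $$\delta\,\alpha(G)\leq \Delta\,\mu(G).$$ Furthermore, if $\delta<\Delta$, then equality $\delta\,\alpha(G)=\Delta\,\mu(G)$ holds if and only if $G$ is bipartite and $(\delta,\Delta)$-regular.
   Context: $\alpha(G)$ denotes the maximum size of an independent set of $G$ and $\mu(G)$ the maximum size of a matching of $G$. For positive integers $\delta<\Delta$, a bipartite graph is called $(\delta,\Delta)$-regular if it has a bipartition with partite sets $A$ and $B$ such that every vertex in $A$ has degree $\delta$ and every vertex in $B$ has degree $\Delta$. -}

module Defs where

open import Data.Nat using (ℕ; _≤_)
open import Data.Empty using (⊥)
open import Data.Bool using (Bool; true; false)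
open import Data.Fin using (Fin)
open import Data.Fin.Subset using (Subset; _∈_; ∣_∣)
open import Data.Vec using (tabulate)
open import Data.List using (List; length; concatMap; _∷_; [])
open import Data.List.Relation.Unary.All using (All)
open import Data.List.Relation.Unary.Unique.Propositional using (Unique)
open import Data.Product using (Σ; _×_; _,_; proj₁; proj₂)
open import Relation.Binary.PropositionalEquality using (_≡_)

record Graph (n : ℕ) : Set where
  field
    adj   : Fin n → Fin n → Bool
    sym   : ∀ i j → adj i j ≡ adj j i
    irrefl : ∀ i → adj i i ≡ false
open Graph public

nbhd : ∀ {n} → Graph n → Fin n → Subset n
nbhd G i = tabulate (adj G i)

deg : ∀ {n} → Graph n → Fin n → ℕ
deg G i = ∣ nbhd G i ∣

IsMinDegree : ∀ {n} → Graph n → ℕ → Set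
IsMinDegree {n} G d = Σ (Fin n) (λ v → deg G v ≡ d) × (∀ v → d ≤ deg G v)

IsMaxDegree : ∀ {n} → Graph n → ℕ → Set
IsMaxDegree {n} G d = Σ (Fin n) (λ v → deg G v ≡ d) × (∀ v → deg G v ≤ d)

IsIndependent : ∀ {n} → Graph n → Subset n → Set
IsIndependent G S = ∀ i j → i ∈ S → j ∈ S → adj G i j ≡ false

IsIndependenceNumber : ∀ {n} → Graph n → ℕ → Set
IsIndependenceNumber {n} G a =
  Σ (Subset n) (λ S → IsIndependent G S × ∣ S ∣ ≡ a)
  × (∀ S → IsIndependent G S → ∣ S ∣ ≤ a)

-- A matching: a list of edges whose endpoints are pairwise distinct
-- (so edges are distinct and pairwise vertex-disjoint).
endpoints : ∀ {n} → List (Fin n × Fin n) → List (Fin n)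
endpoints = concatMap (λ e → proj₁ e ∷ proj₂ e ∷ [])

IsMatching : ∀ {n} → Graph n → List (Fin n × Fin n) → Set
IsMatching G M = All (λ e → adj G (proj₁ e) (proj₂ e) ≡ true) M × Unique (endpoints M)

IsMatchingNumber : ∀ {n} → Graph n → ℕ → Set
IsMatchingNumber {n} G m =
  Σ (List (Fin n × Fin n)) (λ M → IsMatching G M × length M ≡ m)
  × (∀ M → IsMatching G M → length M ≤ m)

IsBipartiteRegular : ∀ {n} → Graph n → ℕ → ℕ → Set
IsBipartiteRegular {n} G δ Δ =
  Σ (Fin n → Bool) λ side →
    (∀ i j → adj G i j ≡ true → side i ≡ side j → ⊥)
    × (∀ v → side v ≡ true → deg G v ≡ δ)
    × (∀ v → side v ≡ false → deg G v ≡ Δ)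

module Submission where

-- Let I be a maximum independent set and consider the bipartite graph of the edges between I and its
-- complement. By König's theorem, found via augmenting paths and a Hungarian forest, it has a matching
-- and a vertex cover C with |C| at most the size of the matching, so |C| ≤ μ. An edge at a
-- vertex of L = I ∖ C cannot stay inside I and must be covered at its other end, so it ends in
-- R = C ∖ I; double counting the edges between L and R gives δ|L| ≤ Δ|R|, and trivially
-- δ|I ∩ C| ≤ Δ|I ∩ C|. Adding, δα = δ|I| ≤ Δ|C| ≤ Δμ.
--
-- If δ < Δ and equality holds, every estimate is tight: I ∩ C is empty, vertices of I have degree δ,
-- vertices of R have degree Δ and only neighbours in I, and maximality of I puts every other vertex
-- into R; so (I, V ∖ I) is a (δ,Δ)-regular bipartition. Conversely, for such a bipartition (A, B),
-- δ|A| = e(A, B) = Δ|B| while |A| ≤ α and μ ≤ |B|.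

open import Data.Bool using (Bool; true; false; _∧_; _∨_; not; if_then_else_)
open import Data.Bool.Properties
  using (∧-conicalˡ; ∧-conicalʳ; ∧-identityʳ; ∧-zeroʳ; ∧-comm; ∨-zeroʳ; not-injective; not-¬)
  renaming (_≟_ to _≟ᴮ_)
open import Data.Empty using (⊥; ⊥-elim)
open import Data.Fin using (Fin; zero; suc; _≟_)
open import Data.Fin.Properties using (any?)
import Data.Fin.Properties as Finₚ
open import Data.Fin.Subset using (Subset; ∣_∣)
open import Data.Fin.Subset.Properties using (∣p∣≤n)
open import Data.List using (List; []; _∷_; length; map)
open import Data.List.Properties using (length-map)
open import Data.List.Membership.Propositional using (_∈_; _∉_)
open import Data.List.Relation.Unary.All using (All; []; _∷_)
import Data.List.Relation.Unary.All as All
open import Data.List.Relation.Unary.All.Properties using (map⁺)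
open import Data.List.Relation.Unary.Any using (here; there)
open import Data.List.Relation.Unary.Unique.Propositional using (Unique; []; _∷_)
open import Data.Maybe using (Maybe; just; nothing; is-just)
open import Data.Maybe.Properties using (just-injective) renaming (≡-dec to ≡-decᴹ)
open import Data.Nat using (ℕ; zero; suc; _+_; _*_; _≤_; _<_; z≤n; s≤s)
open import Data.Nat.Properties hiding (_≟_)
open import Algebra.Properties.Semiring.Sum +-*-semiring
  using (sum; sum-cong-≗; sum-replicate-zero; ∑-comm; ∑-distrib-+; *-distribˡ-sum)
open import Data.Product using (∃-syntax; _×_; _,_; proj₁; proj₂)
open import Data.Sum using (_⊎_; inj₁; inj₂)
open import Data.Vec using (tabulate; lookup)
open import Data.Vec.Properties using (lookup∘tabulate; tabulate∘lookup; []=⇒lookup; lookup⇒[]=)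
open import Data.Vec.Functional using (updateAt)
open import Data.Vec.Functional.Properties using (updateAt-updates; updateAt-minimal)
open import Function using (_∘_; const; id; case_of_)
open import Function.Bundles using (_⇔_; mk⇔)
open import Relation.Nullary using (yes; no; does)
open import Relation.Nullary.Decidable using (dec-true; dec-false; _×-dec_)
open import Relation.Binary.PropositionalEquality

open import Defs hiding (sym)

private variable
  m n : ℕ

+-mono-≤-≡ : ∀ {a b c d} → a ≤ c → b ≤ d → a + b ≡ c + d → a ≡ c × b ≡ d
+-mono-≤-≡ {a} {b} {c} {d} a≤c b≤d a+b≡c+d = a≡c , +-cancelˡ-≡ a b d (trans a+b≡c+d (cong (_+ d) (sym a≡c)))
  where
  a≡c : a ≡ c
  a≡c = ≤-antisym a≤c (+-cancelʳ-≤ d c a (≤-trans (≤-reflexive (sym a+b≡c+d)) (+-monoʳ-≤ a b≤d)))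

≤-squeeze : ∀ {a b c d} → a ≤ b → b ≤ c → c ≤ d → a ≡ d → a ≡ b × b ≡ c × c ≡ d
≤-squeeze a≤b b≤c c≤d a≡d =
  ≤-antisym a≤b (≤-trans b≤c (≤-trans c≤d d≤a)) ,
  ≤-antisym b≤c (≤-trans c≤d (≤-trans d≤a a≤b)) ,
  ≤-antisym c≤d (≤-trans d≤a (≤-trans a≤b b≤c))
  where
  d≤a = ≤-reflexive (sym a≡d)

m<n∧m*k≡n*k⇒k≡0 : ∀ {m n k} → m < n → m * k ≡ n * k → k ≡ 0
m<n∧m*k≡n*k⇒k≡0 {k = zero}  m<n eq = refl
m<n∧m*k≡n*k⇒k≡0 {k = suc k} m<n eq = ⊥-elim (<-irrefl eq (*-monoˡ-< (suc k) m<n))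

_⊆ᵇ_ : (P Q : Fin n → Bool) → Set
P ⊆ᵇ Q = ∀ i → P i ≡ true → Q i ≡ true

sumOn : (Fin n → Bool) → (Fin n → ℕ) → ℕ
sumOn P f = sum λ i → if P i then f i else 0

count : (Fin n → Bool) → ℕ
count P = sumOn P (const 1)

sum-mono-≤ : {f g : Fin n → ℕ} → (∀ i → f i ≤ g i) → sum f ≤ sum g
sum-mono-≤ {zero}  f≤g = z≤n
sum-mono-≤ {suc n} f≤g = +-mono-≤ (f≤g zero) (sum-mono-≤ (f≤g ∘ suc))

sum-mono-≤-≡ : {f g : Fin n → ℕ} → (∀ i → f i ≤ g i) → sum f ≡ sum g → ∀ i → f i ≡ g i
sum-mono-≤-≡ {suc n} f≤g eq i with +-mono-≤-≡ (f≤g zero) (sum-mono-≤ (f≤g ∘ suc)) eq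
sum-mono-≤-≡ {suc n} f≤g eq zero    | eq₀ , _  = eq₀
sum-mono-≤-≡ {suc n} f≤g eq (suc i) | _ , eq₊ = sum-mono-≤-≡ (f≤g ∘ suc) eq₊ i

module _ (P : Fin n → Bool) {f g : Fin n → ℕ} where

  sumOn-cong : (∀ i → P i ≡ true → f i ≡ g i) → sumOn P f ≡ sumOn P g
  sumOn-cong f≗g = sum-cong-≗ pointwise
    where
    pointwise : ∀ i → (if P i then f i else 0) ≡ (if P i then g i else 0)
    pointwise i with P i in Pi
    ... | true  = f≗g i Pi
    ... | false = refl

  private
    restrict-mono : (∀ i → P i ≡ true → f i ≤ g i) → ∀ i → (if P i then f i else 0) ≤ (if P i then g i else 0)
    restrict-mono f≤g i with P i in Pi
    ... | true  = f≤g i Pi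
    ... | false = z≤n

  sumOn-mono-≤ : (∀ i → P i ≡ true → f i ≤ g i) → sumOn P f ≤ sumOn P g
  sumOn-mono-≤ f≤g = sum-mono-≤ (restrict-mono f≤g)

  sumOn-mono-≤-≡ : (∀ i → P i ≡ true → f i ≤ g i) → sumOn P f ≡ sumOn P g → ∀ i → P i ≡ true → f i ≡ g i
  sumOn-mono-≤-≡ f≤g eq i Pi with sum-mono-≤-≡ (restrict-mono f≤g) eq i
  ... | fi≡gi rewrite Pi = fi≡gi

sumOn-const : ∀ (P : Fin n → Bool) c → sumOn P (const c) ≡ c * count P
sumOn-const P c = trans (sum-cong-≗ pointwise) (sym (*-distribˡ-sum c (λ i → if P i then 1 else 0)))
  where
  pointwise : ∀ i → (if P i then c else 0) ≡ c * (if P i then 1 else 0)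
  pointwise i with P i
  ... | true  = sym (*-identityʳ c)
  ... | false = sym (*-zeroʳ c)

count-split : ∀ (P Q : Fin n → Bool) → count P ≡ count (λ i → P i ∧ Q i) + count (λ i → P i ∧ not (Q i))
count-split P Q =
  trans (sum-cong-≗ pointwise) (∑-distrib-+ (λ i → if P i ∧ Q i then 1 else 0) (λ i → if P i ∧ not (Q i) then 1 else 0))
  where
  pointwise : ∀ i → (if P i then 1 else 0) ≡ (if P i ∧ Q i then 1 else 0) + (if P i ∧ not (Q i) then 1 else 0)
  pointwise i with P i | Q i
  ... | true  | true  = refl
  ... | true  | false = refl
  ... | false | _     = refl

count-cong : {P Q : Fin n → Bool} → (∀ i → P i ≡ Q i) → count P ≡ count Q
count-cong P≗Q = sum-cong-≗ λ i → cong (λ b → if b then 1 else 0) (P≗Q i)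

module _ {P Q : Fin n → Bool} (P⊆Q : P ⊆ᵇ Q) where

  private
    indicator-mono : ∀ i → (if P i then 1 else 0) ≤ (if Q i then 1 else 0)
    indicator-mono i with P i in Pi
    ... | false = z≤n
    ... | true rewrite P⊆Q i Pi = ≤-refl

  count-mono : count P ≤ count Q
  count-mono = sum-mono-≤ indicator-mono

  count-mono-≡ : count P ≡ count Q → Q ⊆ᵇ P
  count-mono-≡ eq i Qi with P i | sum-mono-≤-≡ indicator-mono eq i
  ... | true  | _ = refl
  ... | false | 0≡Qi rewrite Qi = ⊥-elim (0≢1+n 0≡Qi)

count-false : ∀ n → count {n} (const false) ≡ 0
count-false = sum-replicate-zero

count-≡0 : (P : Fin n → Bool) → count P ≡ 0 → ∀ i → P i ≡ false
count-≡0 {n} P eq i with P i in Pi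
... | false = refl
... | true with count-mono-≡ {P = const false} {Q = P} (λ _ ()) (trans (count-false n) (sym eq)) i Pi
...   | ()

private
  count-restrict : ∀ b (Q : Fin n → Bool) → (if b then count Q else 0) ≡ count (λ y → b ∧ Q y)
  count-restrict {n} true  Q = refl
  count-restrict {n} false Q = sym (count-false n)

sumOn-count-comm : ∀ (P Q : Fin n → Bool) (R : Fin n → Fin n → Bool) → (∀ x y → R x y ≡ R y x) →
  sumOn P (λ x → count (λ y → Q y ∧ R x y)) ≡ sumOn Q (λ y → count (λ x → P x ∧ R y x))
sumOn-count-comm P Q R R-sym = begin
  sumOn P (λ x → count (λ y → Q y ∧ R x y))
    ≡⟨ sum-cong-≗ (λ x → count-restrict (P x) (λ y → Q y ∧ R x y)) ⟩
  sum (λ x → count (λ y → P x ∧ (Q y ∧ R x y)))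
    ≡⟨ ∑-comm (λ x y → if P x ∧ (Q y ∧ R x y) then 1 else 0) ⟩
  sum (λ y → count (λ x → P x ∧ (Q y ∧ R x y)))
    ≡⟨ sum-cong-≗ (λ y → count-cong (λ x → swap x y)) ⟩
  sum (λ y → count (λ x → Q y ∧ (P x ∧ R y x)))
    ≡⟨ sum-cong-≗ (λ y → count-restrict (Q y) (λ x → P x ∧ R y x)) ⟨
  sumOn Q (λ y → count (λ x → P x ∧ R y x))
    ∎
  where
  open ≡-Reasoning
  swap : ∀ x y → P x ∧ (Q y ∧ R x y) ≡ Q y ∧ (P x ∧ R y x)
  swap x y rewrite R-sym x y with P x | Q y
  ... | true  | true  = refl
  ... | true  | false = refl
  ... | false | true  = refl
  ... | false | false = refl

_∖_ : (Fin n → Bool) → Fin n → Fin n → Bool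
(P ∖ x) v = P v ∧ not (does (v ≟ x))

count-remove : ∀ (P : Fin n → Bool) {x} → P x ≡ true → count P ≡ suc (count (P ∖ x))
count-remove {suc n} P {zero} P0 rewrite P0 = cong suc (count-cong λ v → sym (∧-identityʳ (P (suc v))))
count-remove {suc n} P {suc x} Px with P zero | count-remove (P ∘ suc) Px
... | true  | eq = cong suc eq
... | false | eq = eq

count-insert : ∀ {P Q : Fin n → Bool} {y} → P ⊆ᵇ Q → P y ≡ false → Q y ≡ true → suc (count P) ≤ count Q
count-insert {P = P} {Q} {y} P⊆Q Py Qy = begin
  suc (count P)       ≤⟨ s≤s (count-mono P⊆Q∖y) ⟩
  suc (count (Q ∖ y)) ≡⟨ count-remove Q Qy ⟨
  count Q             ∎
  where
  open ≤-Reasoning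
  P⊆Q∖y : P ⊆ᵇ (Q ∖ y)
  P⊆Q∖y v Pv with v ≟ y
  ... | no _ rewrite P⊆Q v Pv = refl
  ... | yes refl with () ← trans (sym Pv) Py

∖⇒≢ : ∀ (P : Fin n → Bool) {x y} → (P ∖ y) x ≡ true → x ≢ y
∖⇒≢ P {x} P∖xx refl rewrite dec-true (x ≟ x) refl | ∧-zeroʳ (P x) with () ← P∖xx

∖-intro : ∀ (P : Fin n → Bool) {x y} → P x ≡ true → x ≢ y → (P ∖ y) x ≡ true
∖-intro P {x} {y} Px x≢y rewrite dec-false (x ≟ y) x≢y | Px = refl

count-≤-remove : ∀ (P : Fin n → Bool) x → count P ≤ suc (count (P ∖ x))
count-≤-remove P x with P x in Px
... | true  = ≤-reflexive (count-remove P Px)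
... | false = m≤n⇒m≤1+n (count-mono P⊆P∖x)
  where
  P⊆P∖x : P ⊆ᵇ (P ∖ x)
  P⊆P∖x v Pv with v ≟ x
  ... | no _ rewrite Pv = refl
  ... | yes refl with () ← trans (sym Pv) Px

private
  image-tail : ∀ {Q : Fin (suc m) → Bool} {f : Fin (suc m) → Maybe (Fin n)} {x} →
               ∃[ y ] Q y ≡ true × f y ≡ just x → (Q zero ≡ true → f zero ≢ just x) →
               ∃[ y ] Q (suc y) ≡ true × f (suc y) ≡ just x
  image-tail (suc y , Qy , fy) _        = y , Qy , fy
  image-tail (zero  , Q0 , f0) not-zero = ⊥-elim (not-zero Q0 f0)

count-image : ∀ {P : Fin n → Bool} {Q : Fin m → Bool} (f : Fin m → Maybe (Fin n)) →
              (∀ x → P x ≡ true → ∃[ y ] Q y ≡ true × f y ≡ just x) → count P ≤ count Q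
count-image {n} {zero} {P} f P⊆image = ≤-trans (count-mono P⊆∅) (≤-reflexive (count-false n))
  where
  P⊆∅ : P ⊆ᵇ const false
  P⊆∅ x Px with () ← proj₁ (P⊆image x Px)
count-image {n} {suc m} {P} {Q} f P⊆image with Q zero in Q0 | f zero in f0
... | false | _       = count-image (f ∘ suc) λ x Px →
                        image-tail (P⊆image x Px) λ Q0′ _ → not-¬ Q0′ Q0
... | true  | nothing = m≤n⇒m≤1+n (count-image (f ∘ suc) λ x Px →
                        image-tail (P⊆image x Px) λ _ f0′ → case trans (sym f0) f0′ of λ ())
... | true  | just x₀ = ≤-trans (count-≤-remove P x₀) (s≤s (count-image (f ∘ suc) λ x P∖x₀x →
                        image-tail (P⊆image x (∧-conicalˡ _ _ P∖x₀x)) λ _ f0′ →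
                        ∖⇒≢ P P∖x₀x (just-injective (trans (sym f0′) f0))))

length≤count : ∀ (P : Fin n → Bool) {xs} → Unique xs → All (λ x → P x ≡ true) xs → length xs ≤ count P
length≤count P {[]}     []              []         = z≤n
length≤count P {x ∷ xs} (x∉xs ∷ unique) (Px ∷ Pxs) = begin
  suc (length xs)     ≤⟨ s≤s (length≤count (P ∖ x) unique (All.zipWith P∖x (Pxs , x∉xs))) ⟩
  suc (count (P ∖ x)) ≡⟨ count-remove P Px ⟨
  count P             ∎
  where
  open ≤-Reasoning
  P∖x : ∀ {z} → P z ≡ true × x ≢ z → (P ∖ x) z ≡ true
  P∖x (Pz , x≢z) = ∖-intro P Pz (x≢z ∘ sym)

∣tabulate∣≡count : ∀ (P : Fin n → Bool) → ∣ tabulate P ∣ ≡ count P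
∣tabulate∣≡count {zero}  P = refl
∣tabulate∣≡count {suc n} P with P zero | ∣tabulate∣≡count (P ∘ suc)
... | true  | eq = cong suc eq
... | false | eq = eq

count≤n : ∀ (P : Fin n → Bool) → count P ≤ n
count≤n P = ≤-trans (≤-reflexive (sym (∣tabulate∣≡count P))) (∣p∣≤n (tabulate P))

insert : (Fin n → Bool) → Fin n → Fin n → Bool
insert P x v = P v ∨ does (v ≟ x)

insert-⊇ : ∀ (P : Fin n → Bool) x → P ⊆ᵇ insert P x
insert-⊇ P x v Pv rewrite Pv = refl

insert-new : ∀ (P : Fin n → Bool) x → insert P x x ≡ true
insert-new P x rewrite dec-true (x ≟ x) refl = ∨-zeroʳ (P x)

insert-cases : ∀ (P : Fin n → Bool) x {v} → insert P x v ≡ true → P v ≡ true ⊎ v ≡ x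
insert-cases P x {v} eq with P v | v ≟ x
... | true  | _        = inj₁ refl
... | false | yes v≡x  = inj₂ v≡x
... | false | no _ with () ← eq

-- e labels the right vertices so that the recursion can run over Fin k.
mateList : ∀ {k} → (Fin k → Fin n) → (Fin k → Maybe (Fin n)) → List (Fin n × Fin n)
mateList {k = zero}  e r = []
mateList {k = suc k} e r with r zero
... | just x  = (x , e zero) ∷ mateList (e ∘ suc) (r ∘ suc)
... | nothing = mateList (e ∘ suc) (r ∘ suc)

length-mateList : ∀ {k} (e : Fin k → Fin n) r → length (mateList e r) ≡ count (is-just ∘ r)
length-mateList {k = zero}  e r = refl
length-mateList {k = suc k} e r with r zero
... | just _  = cong suc (length-mateList (e ∘ suc) (r ∘ suc))
... | nothing = length-mateList (e ∘ suc) (r ∘ suc)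

All-mateList : ∀ {k} (A : Fin n → Fin n → Bool) (e : Fin k → Fin n) r →
               (∀ i {x} → r i ≡ just x → A x (e i) ≡ true) →
               All (λ p → A (proj₁ p) (proj₂ p) ≡ true) (mateList e r)
All-mateList {k = zero}  A e r edge = []
All-mateList {k = suc k} A e r edge with r zero in r0
... | just _  = edge zero r0 ∷ All-mateList A (e ∘ suc) (r ∘ suc) (edge ∘ suc)
... | nothing = All-mateList A (e ∘ suc) (r ∘ suc) (edge ∘ suc)

∈-endpoints-mateList : ∀ {k} (e : Fin k → Fin n) r {z} → z ∈ endpoints (mateList e r) →
                       ∃[ i ] ∃[ x ] r i ≡ just x × (z ≡ x ⊎ z ≡ e i)
∈-endpoints-mateList {k = suc k} e r z∈ with r zero in r0 | z∈
... | just x  | here refl         = zero , x , r0 , inj₁ refl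
... | just x  | there (here refl) = zero , x , r0 , inj₂ refl
... | just _  | there (there z∈′) = let i , rest = ∈-endpoints-mateList (e ∘ suc) (r ∘ suc) z∈′ in suc i , rest
... | nothing | z∈′               = let i , rest = ∈-endpoints-mateList (e ∘ suc) (r ∘ suc) z∈′ in suc i , rest

module _ (I : Fin n → Bool) where

  private
    separated : ∀ {a b} → I a ≡ true → I b ≡ false → a ≢ b
    separated Ia Ib refl with () ← trans (sym Ia) Ib

  Unique-mateList : ∀ {k} (e : Fin k → Fin n) r →
                    (∀ {i x} → r i ≡ just x → I x ≡ true × I (e i) ≡ false) →
                    (∀ {i j x} → r i ≡ just x → r j ≡ just x → i ≡ j) →
                    (∀ {i j} → e i ≡ e j → i ≡ j) → Unique (endpoints (mateList e r))
  Unique-mateList {k = zero}  e r sides r-injective e-injective = []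
  Unique-mateList {k = suc k} e r sides r-injective e-injective with r zero in r0
  ... | nothing = Unique-mateList (e ∘ suc) (r ∘ suc) (λ {i} → sides {suc i})
                    (λ ri rj → Finₚ.suc-injective (r-injective ri rj)) (Finₚ.suc-injective ∘ e-injective)
  ... | just x  = All.tabulate x∉ ∷ All.tabulate e₀∉ ∷ Unique-mateList (e ∘ suc) (r ∘ suc) (λ {i} → sides {suc i})
                    (λ ri rj → Finₚ.suc-injective (r-injective ri rj)) (Finₚ.suc-injective ∘ e-injective)
    where
    Ix  = proj₁ (sides r0)
    Ie₀ = proj₂ (sides r0)
    x∉ : ∀ {z} → z ∈ e zero ∷ endpoints (mateList (e ∘ suc) (r ∘ suc)) → x ≢ z
    x∉ (here refl) = separated Ix Ie₀
    x∉ (there z∈) with ∈-endpoints-mateList (e ∘ suc) (r ∘ suc) z∈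
    ... | i , x′ , ri , inj₁ refl = λ { refl → Finₚ.0≢1+n (r-injective r0 ri) }
    ... | i , x′ , ri , inj₂ refl = separated Ix (proj₂ (sides ri))
    e₀∉ : ∀ {z} → z ∈ endpoints (mateList (e ∘ suc) (r ∘ suc)) → e zero ≢ z
    e₀∉ z∈ with ∈-endpoints-mateList (e ∘ suc) (r ∘ suc) z∈
    ... | i , x′ , ri , inj₁ refl = separated (proj₁ (sides ri)) Ie₀ ∘ sym
    ... | i , x′ , ri , inj₂ refl = Finₚ.0≢1+n ∘ e-injective

-- The bipartite graph with left part I, right part its complement and edges E x y from x ∈ I to y ∉ I.
-- A matching is stored as the partial map sending each right vertex to its mate.
module König {n} (I : Fin n → Bool) (E : Fin n → Fin n → Bool) where

  Mates : Set
  Mates = Fin n → Maybe (Fin n)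

  record IsMatchingMap (r : Mates) : Set where
    field
      mate-edge      : ∀ {y x} → r y ≡ just x → I x ≡ true × I y ≡ false × E x y ≡ true
      mate-injective : ∀ {y y′ x} → r y ≡ just x → r y′ ≡ just x → y ≡ y′
  open IsMatchingMap

  matched : Mates → Fin n → Bool
  matched r y = is-just (r y)

  size : Mates → ℕ
  size r = count (matched r)

  Exposed : Mates → Fin n → Set
  Exposed r x = ∀ y → r y ≢ just x

  IsCover : (Fin n → Bool) → Set
  IsCover C = ∀ {x y} → I x ≡ true → I y ≡ false → E x y ≡ true → C x ≡ true ⊎ C y ≡ true

  _[_≔_] : Mates → Fin n → Maybe (Fin n) → Mates
  r [ y ≔ m ] = updateAt r y (const m)

  ≔-cases : ∀ r y m {v w} → (r [ y ≔ m ]) v ≡ just w → (v ≡ y × m ≡ just w) ⊎ (v ≢ y × r v ≡ just w)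
  ≔-cases r y m {v} eq with v ≟ y
  ... | yes refl = inj₁ (refl , trans (sym (updateAt-updates y r)) eq)
  ... | no v≢y   = inj₂ (v≢y , trans (sym (updateAt-minimal v y r v≢y)) eq)

  ≔-⊆ : ∀ r y {v w} → (r [ y ≔ nothing ]) v ≡ just w → r v ≡ just w
  ≔-⊆ r y eq with ≔-cases r y nothing eq
  ... | inj₂ (_ , eq′) = eq′

  IsMatchingMap-⊆ : ∀ {r r′} → (∀ {v w} → r′ v ≡ just w → r v ≡ just w) → IsMatchingMap r → IsMatchingMap r′
  IsMatchingMap-⊆ r′⊆r M .mate-edge      eq     = mate-edge M (r′⊆r eq)
  IsMatchingMap-⊆ r′⊆r M .mate-injective eq eq′ = mate-injective M (r′⊆r eq) (r′⊆r eq′)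

  assign : ∀ {r x y} → IsMatchingMap r → Exposed r x →
           I x ≡ true → I y ≡ false → E x y ≡ true → IsMatchingMap (r [ y ≔ just x ])
  assign {r} {x} {y} M exposed Ix Iy Exy = record { mate-edge = edge ; mate-injective = injective }
    where
    edge : ∀ {v w} → (r [ y ≔ just x ]) v ≡ just w → I w ≡ true × I v ≡ false × E w v ≡ true
    edge eq with ≔-cases r y (just x) eq
    ... | inj₁ (refl , refl) = Ix , Iy , Exy
    ... | inj₂ (_ , eq′)     = mate-edge M eq′
    injective : ∀ {v v′ w} → (r [ y ≔ just x ]) v ≡ just w → (r [ y ≔ just x ]) v′ ≡ just w → v ≡ v′
    injective eq eq′ with ≔-cases r y (just x) eq | ≔-cases r y (just x) eq′
    ... | inj₁ (refl , _)    | inj₁ (refl , _)     = refl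
    ... | inj₁ (_ , refl)    | inj₂ (_ , rv′≡x)    = ⊥-elim (exposed _ rv′≡x)
    ... | inj₂ (_ , rv≡x)    | inj₁ (_ , refl)     = ⊥-elim (exposed _ rv≡x)
    ... | inj₂ (_ , rv≡w)    | inj₂ (_ , rv′≡w)    = mate-injective M rv≡w rv′≡w

  ≔-just-matched : ∀ r y x → matched (r [ y ≔ just x ]) y ≡ true
  ≔-just-matched r y x = cong is-just (updateAt-updates y r)

  ≔-just-extends : ∀ r y x → matched r ⊆ᵇ matched (r [ y ≔ just x ])
  ≔-just-extends r y x v rv with v ≟ y
  ... | yes refl = ≔-just-matched r y x
  ... | no v≢y   = trans (cong is-just (updateAt-minimal v y r v≢y)) rv

  -- x is reached from an exposed left vertex by an r-alternating path with distinct right vertices ys.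
  data AltPath (r : Mates) : Fin n → List (Fin n) → Set where
    start  : ∀ {x} → I x ≡ true → Exposed r x → AltPath r x []
    extend : ∀ {x₀ y x ys} → AltPath r x₀ ys → E x₀ y ≡ true → r y ≡ just x → y ∉ ys → AltPath r x (y ∷ ys)

  AltPath-transport : ∀ {r r′ x ys} → (∀ {x} → Exposed r x → Exposed r′ x) →
                      All (λ z → r′ z ≡ r z) ys → AltPath r x ys → AltPath r′ x ys
  AltPath-transport exposed′ []           (start Ix exposed)      = start Ix (exposed′ exposed)
  AltPath-transport exposed′ (r′y≡ry ∷ eqs) (extend p Exy ry y∉ys) =
    extend (AltPath-transport exposed′ eqs p) Exy (trans r′y≡ry ry) y∉ys

  record Augmentation (r : Mates) (y : Fin n) : Set where
    field
      mates      : Mates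
      isMatching : IsMatchingMap mates
      extends    : matched r ⊆ᵇ matched mates
      covers     : matched mates y ≡ true

  move : Mates → Fin n → Fin n → Fin n → Mates
  move r y₁ y x = (r [ y₁ ≔ nothing ]) [ y ≔ just x ]

  module _ {r y₁ x} (M : IsMatchingMap r) (ry₁ : r y₁ ≡ just x) where

    move-isMatching : ∀ {y} → I y ≡ false → E x y ≡ true → IsMatchingMap (move r y₁ y x)
    move-isMatching Iy Exy = assign (IsMatchingMap-⊆ (≔-⊆ r y₁) M) exposed Ix Iy Exy
      where
      Ix = proj₁ (mate-edge M ry₁)
      exposed : Exposed (r [ y₁ ≔ nothing ]) x
      exposed v r₀v≡x with ≔-cases r y₁ nothing r₀v≡x
      ... | inj₂ (v≢y₁ , rv≡x) = v≢y₁ (mate-injective M rv≡x ry₁)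

    move-exposed : ∀ {y x′} → Exposed r x′ → Exposed (move r y₁ y x) x′
    move-exposed {y} exposed v r₁v≡x′ with ≔-cases (r [ y₁ ≔ nothing ]) y (just x) r₁v≡x′
    ... | inj₁ (_ , refl)   = exposed y₁ ry₁
    ... | inj₂ (_ , r₀v≡x′) = exposed v (≔-⊆ r y₁ r₀v≡x′)

  move-other : ∀ r y₁ y x {z} → z ≢ y₁ → z ≢ y → move r y₁ y x z ≡ r z
  move-other r y₁ y x {z} z≢y₁ z≢y = trans (updateAt-minimal z y _ z≢y) (updateAt-minimal z y₁ r z≢y₁)

  augment : ∀ {r x y ys} → IsMatchingMap r → AltPath r x ys →
            I y ≡ false → E x y ≡ true → y ∉ ys → Augmentation r y
  augment {r} {x} {y} M (start Ix exposed) Iy Exy _ = record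
    { mates      = r [ y ≔ just x ]
    ; isMatching = assign M exposed Ix Iy Exy
    ; extends    = ≔-just-extends r y x
    ; covers     = ≔-just-matched r y x
    }
  augment {r} {x} {y} M (extend {y = y₁} {ys = ys} p₀ E₀ ry₁ y₁∉ys) Iy Exy y∉path = record
    { mates      = mates rest
    ; isMatching = isMatching rest
    ; extends    = extends′
    ; covers     = extends rest y (≔-just-matched (r [ y₁ ≔ nothing ]) y x)
    }
    where
    open Augmentation
    agree : ∀ {z} → z ∈ ys → move r y₁ y x z ≡ r z
    agree z∈ys = move-other r y₁ y x (λ { refl → y₁∉ys z∈ys }) (λ { refl → y∉path (there z∈ys) })
    rest : Augmentation (move r y₁ y x) y₁
    rest = augment (move-isMatching M ry₁ Iy Exy) (AltPath-transport (move-exposed M ry₁) (All.tabulate agree) p₀)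
                   (proj₁ (proj₂ (mate-edge M ry₁))) E₀ y₁∉ys
    extends′ : matched r ⊆ᵇ matched (mates rest)
    extends′ v rv with v ≟ y₁
    ... | yes refl = covers rest
    ... | no v≢y₁  = extends rest v (≔-just-extends _ y x v (trans (cong is-just (updateAt-minimal v y₁ r v≢y₁)) rv))

  -- X and Y are the left and right vertices of a Hungarian forest rooted at the exposed left vertices.
  record Forest (r : Mates) (X Y : Fin n → Bool) : Set where
    field
      exposed⊆X   : ∀ {x} → I x ≡ true → Exposed r x → X x ≡ true
      X-reachable : ∀ {x} → X x ≡ true → ∃[ ys ] AltPath r x ys × All (λ y → Y y ≡ true) ys
      Y-matched   : ∀ {y} → Y y ≡ true → ∃[ x ] r y ≡ just x × X x ≡ true
  open Forest

  Closed : (X Y : Fin n → Bool) → Set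
  Closed X Y = ∀ {x y} → X x ≡ true → I y ≡ false → E x y ≡ true → Y y ≡ true

  exposed? : Mates → Fin n → Bool
  exposed? r x = not (does (any? λ y → ≡-decᴹ _≟_ (r y) (just x)))

  exposed?-complete : ∀ r {x} → Exposed r x → exposed? r x ≡ true
  exposed?-complete r {x} exposed with any? (λ y → ≡-decᴹ _≟_ (r y) (just x))
  ... | yes (y , ry≡x) = ⊥-elim (exposed y ry≡x)
  ... | no _           = refl

  exposed?-sound : ∀ r {x} → exposed? r x ≡ true → Exposed r x
  exposed?-sound r {x} eq y ry≡x with any? (λ y → ≡-decᴹ _≟_ (r y) (just x))
  ... | no none = none (y , ry≡x)

  initial-forest : ∀ r → Forest r (λ x → I x ∧ exposed? r x) (const false)
  initial-forest r .exposed⊆X   Ix exposed rewrite Ix = exposed?-complete r exposed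
  initial-forest r .X-reachable {x} X₀x =
    [] , start (∧-conicalˡ (I x) _ X₀x) (exposed?-sound r (∧-conicalʳ (I x) _ X₀x)) , []
  initial-forest r .Y-matched ()

  Forest-extend : ∀ {r X Y x y x′} → Forest r X Y → X x ≡ true → Y y ≡ false → E x y ≡ true → r y ≡ just x′ →
                  Forest r (insert X x′) (insert Y y)
  Forest-extend {X = X} {x′ = x′} F Xx Yy Exy ry .exposed⊆X Iv exposed = insert-⊇ X x′ _ (exposed⊆X F Iv exposed)
  Forest-extend {X = X} {Y} {x} {y} {x′} F Xx Yy Exy ry .X-reachable {v} X′v with insert-cases X x′ X′v
  ... | inj₁ Xv with X-reachable F Xv
  ...   | ys , p , Y-ys = ys , p , All.map (insert-⊇ Y y _) Y-ys
  Forest-extend {X = X} {Y} {x} {y} {x′} F Xx Yy Exy ry .X-reachable X′v | inj₂ refl with X-reachable F Xx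
  ...   | ys , p , Y-ys = y ∷ ys , extend p Exy ry y∉ys , insert-new Y y ∷ All.map (insert-⊇ Y y _) Y-ys
    where
    y∉ys : y ∉ ys
    y∉ys y∈ys with () ← trans (sym (All.lookup Y-ys y∈ys)) Yy
  Forest-extend {X = X} {Y} {x} {y} {x′} F Xx Yy Exy ry .Y-matched Y′v with insert-cases Y y Y′v
  ... | inj₁ Yv with Y-matched F Yv
  ...   | x″ , rv , Xx″ = x″ , rv , insert-⊇ X x′ x″ Xx″
  Forest-extend {X = X} {Y} {x} {y} {x′} F Xx Yy Exy ry .Y-matched Y′v | inj₂ refl = x′ , ry , insert-new X x′

  private
    OpenEdge : (X Y : Fin n → Bool) → Fin n → Fin n → Set
    OpenEdge X Y x y = X x ≡ true × Y y ≡ false × I y ≡ false × E x y ≡ true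

  open-edge? : ∀ X Y → (∃[ x ] ∃[ y ] OpenEdge X Y x y) ⊎ Closed X Y
  open-edge? X Y with any? (λ x → any? λ y →
    (X x ≟ᴮ true) ×-dec (Y y ≟ᴮ false) ×-dec (I y ≟ᴮ false) ×-dec (E x y ≟ᴮ true))
  ... | yes (x , y , open-edge) = inj₁ (x , y , open-edge)
  ... | no none                 = inj₂ closed
    where
    closed : Closed X Y
    closed {x} {y} Xx Iy Exy with Y y in Yy
    ... | true  = refl
    ... | false = ⊥-elim (none (x , y , Xx , Yy , Iy , Exy))

  ClosedForest : Mates → Set
  ClosedForest r = ∃[ X ] ∃[ Y ] Forest r X Y × Closed X Y

  Growth : Mates → Set
  Growth r = (∃[ r′ ] IsMatchingMap r′ × size r < size r′) ⊎ ClosedForest r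

  private
    not∘insert-⊆ : ∀ (P : Fin n → Bool) x → (not ∘ insert P x) ⊆ᵇ (not ∘ P)
    not∘insert-⊆ P x v with P v
    ... | false = λ _ → refl
    ... | true  = λ ()

  grow : ∀ fuel {r X Y} → IsMatchingMap r → Forest r X Y → count (not ∘ Y) ≤ fuel → Growth r
  grow fuel {r} {X} {Y} M F bound with open-edge? X Y
  ... | inj₂ closed = inj₂ (X , Y , F , closed)
  ... | inj₁ (x , y , Xx , Yy , Iy , Exy) with r y in ry
  ...   | nothing = inj₁ (mates aug , isMatching aug , count-insert (extends aug) (cong is-just ry) (covers aug))
    where
    open Augmentation
    path = X-reachable F Xx
    y∉path : y ∉ proj₁ path
    y∉path y∈ys with () ← trans (sym (All.lookup (proj₂ (proj₂ path)) y∈ys)) Yy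
    aug = augment M (proj₁ (proj₂ path)) Iy Exy y∉path
  ...   | just x′ = grow-on fuel bound
    where
    shrink : suc (count (not ∘ insert Y y)) ≤ count (not ∘ Y)
    shrink = count-insert (not∘insert-⊆ Y y) (cong not (insert-new Y y)) (cong not Yy)
    grow-on : ∀ fuel → count (not ∘ Y) ≤ fuel → Growth r
    grow-on zero       bound = ⊥-elim (n≮0 (≤-trans shrink bound))
    grow-on (suc fuel) bound = grow fuel M (Forest-extend F Xx Yy Exy ry) (≤-pred (≤-trans shrink bound))

  closed-forest : ∀ fuel r → IsMatchingMap r → n ≤ size r + fuel → ∃[ r′ ] IsMatchingMap r′ × ClosedForest r′
  closed-forest fuel r M bound with grow n M (initial-forest r) (count≤n (not ∘ const false))
  ... | inj₂ closed = r , M , closed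
  ... | inj₁ (r′ , M′ , r<r′) with fuel
  ...   | zero     = ⊥-elim (<⇒≱ r<r′ (≤-trans (count≤n (matched r′)) (subst (n ≤_) (+-identityʳ (size r)) bound)))
  ...   | suc fuel = closed-forest fuel r′ M′
                       (≤-trans bound (≤-trans (≤-reflexive (+-suc (size r) fuel)) (+-monoˡ-≤ fuel r<r′)))

  cover : (X Y : Fin n → Bool) → Fin n → Bool
  cover X Y v = if I v then not (X v) else Y v

  cover-isCover : ∀ {X Y} → Closed X Y → IsCover (cover X Y)
  cover-isCover {X} {Y} closed {x} {y} Ix Iy Exy rewrite Ix | Iy with X x in Xx
  ... | true  = inj₂ (closed Xx Iy Exy)
  ... | false = inj₁ refl

  module _ {r X Y} (F : Forest r X Y) where

    count-I∖X≤matched∖Y : count (λ v → I v ∧ not (X v)) ≤ count (λ v → matched r v ∧ not (Y v))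
    count-I∖X≤matched∖Y = count-image r mate
      where
      mate : ∀ x → I x ∧ not (X x) ≡ true → ∃[ y ] matched r y ∧ not (Y y) ≡ true × r y ≡ just x
      mate x IX̄x = mated (∧-conicalˡ (I x) _ IX̄x) (not-injective (∧-conicalʳ (I x) _ IX̄x))
        where
        mated : I x ≡ true → X x ≡ false → ∃[ y ] matched r y ∧ not (Y y) ≡ true × r y ≡ just x
        mated Ix Xx with any? (λ y → ≡-decᴹ _≟_ (r y) (just x))
        ... | no none = ⊥-elim (not-¬ (exposed⊆X F Ix λ y ry → none (y , ry)) Xx)
        ... | yes (y , ry) with Y y in Yy
        ...   | false = y , cong₂ (λ m b → is-just m ∧ not b) ry Yy , ry
        ...   | true with Y-matched F Yy
        ...     | _ , ry″ , Xx″ with refl ← just-injective (trans (sym ry) ry″) = ⊥-elim (not-¬ Xx″ Xx)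

    count-Y≤matched∩Y : count (λ v → not (I v) ∧ Y v) ≤ count (λ v → matched r v ∧ Y v)
    count-Y≤matched∩Y = count-mono matched-Y
      where
      matched-Y : (λ v → not (I v) ∧ Y v) ⊆ᵇ (λ v → matched r v ∧ Y v)
      matched-Y v I̅Yv with Yv ← ∧-conicalʳ (not (I v)) _ I̅Yv rewrite Yv | proj₁ (proj₂ (Y-matched F Yv)) = refl

    count-cover≤size : count (cover X Y) ≤ size r
    count-cover≤size = begin
      count C                                                                 ≡⟨ count-split C I ⟩
      count (λ v → C v ∧ I v) + count (λ v → C v ∧ not (I v))
        ≡⟨ cong₂ _+_ (count-cong on-I) (count-cong off-I) ⟩
      count (λ v → I v ∧ not (X v)) + count (λ v → not (I v) ∧ Y v)
        ≤⟨ +-mono-≤ count-I∖X≤matched∖Y count-Y≤matched∩Y ⟩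
      count (λ v → matched r v ∧ not (Y v)) + count (λ v → matched r v ∧ Y v)
        ≡⟨ +-comm (count (λ v → matched r v ∧ not (Y v))) _ ⟩
      count (λ v → matched r v ∧ Y v) + count (λ v → matched r v ∧ not (Y v)) ≡⟨ count-split (matched r) Y ⟨
      size r                                                                  ∎
      where
      open ≤-Reasoning
      C = cover X Y
      on-I : ∀ v → C v ∧ I v ≡ I v ∧ not (X v)
      on-I v with I v
      ... | true  = ∧-identityʳ (not (X v))
      ... | false = ∧-zeroʳ (Y v)
      off-I : ∀ v → C v ∧ not (I v) ≡ not (I v) ∧ Y v
      off-I v with I v
      ... | true  = ∧-zeroʳ (not (X v))
      ... | false = ∧-identityʳ (Y v)

  no-mates : IsMatchingMap (const nothing)
  no-mates .mate-edge      ()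
  no-mates .mate-injective ()

  mateList-isMatching : ∀ {r} → IsMatchingMap r →
                        All (λ e → E (proj₁ e) (proj₂ e) ≡ true) (mateList id r) × Unique (endpoints (mateList id r))
  mateList-isMatching {r} M =
    All-mateList E id r (λ _ ri → proj₂ (proj₂ (mate-edge M ri))) ,
    Unique-mateList I id r (λ ri → proj₁ (mate-edge M ri) , proj₁ (proj₂ (mate-edge M ri))) (mate-injective M) id

  matching-and-cover : ∃[ r ] IsMatchingMap r × ∃[ C ] IsCover C × count C ≤ size r
  matching-and-cover with closed-forest n (const nothing) no-mates (≤-reflexive (cong (_+ n) (sym (count-false n))))
  ... | r , M , X , Y , F , closed = r , M , cover X Y , cover-isCover closed , count-cover≤size F

endpoints-∈ : ∀ {M : List (Fin n × Fin n)} {a b} → (a , b) ∈ M → a ∈ endpoints M × b ∈ endpoints M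
endpoints-∈ (here refl) = here refl , there (here refl)
endpoints-∈ (there q∈M) = let a∈ , b∈ = endpoints-∈ q∈M in there (there a∈) , there (there b∈)

Unique-map-endpoint : ∀ (c : Fin n × Fin n → Fin n) → (∀ a b → c (a , b) ≡ a ⊎ c (a , b) ≡ b) →
                      ∀ {M} → Unique (endpoints M) → Unique (map c M)
Unique-map-endpoint c endpoint {[]}          []               = []
Unique-map-endpoint c endpoint {(a , b) ∷ M} (a∉ ∷ b∉ ∷ unique) =
  map⁺ (All.tabulate distinct) ∷ Unique-map-endpoint c endpoint unique
  where
  c∈ : ∀ {q} → q ∈ M → c q ∈ endpoints M
  c∈ {a′ , b′} q∈M with endpoint a′ b′
  ... | inj₁ eq rewrite eq = proj₁ (endpoints-∈ q∈M)
  ... | inj₂ eq rewrite eq = proj₂ (endpoints-∈ q∈M)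
  distinct : ∀ {q} → q ∈ M → c (a , b) ≢ c q
  distinct q∈M eq with endpoint a b
  ... | inj₁ ca = All.lookup a∉ (there (c∈ q∈M)) (trans (sym ca) eq)
  ... | inj₂ cb = All.lookup b∉ (c∈ q∈M) (trans (sym cb) eq)

module _ (G : Graph n) where

  IsIndependentᵇ : (Fin n → Bool) → Set
  IsIndependentᵇ P = ∀ {x y} → P x ≡ true → P y ≡ true → adj G x y ≡ false

  IsIndependent-lookup : ∀ {S} → IsIndependent G S → IsIndependentᵇ (lookup S)
  IsIndependent-lookup {S} independent {x} {y} Sx Sy = independent x y (lookup⇒[]= x S Sx) (lookup⇒[]= y S Sy)

  IsIndependent-tabulate : ∀ {P : Fin n → Bool} → IsIndependentᵇ P → IsIndependent G (tabulate P)
  IsIndependent-tabulate {P} independent x y x∈ y∈ =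
    independent (trans (sym (lookup∘tabulate P x)) ([]=⇒lookup x∈)) (trans (sym (lookup∘tabulate P y)) ([]=⇒lookup y∈))

  deg≡count : ∀ v → deg G v ≡ count (adj G v)
  deg≡count v = ∣tabulate∣≡count (adj G v)

  deg≡count-within : ∀ {Q : Fin n → Bool} {x} → (∀ {y} → adj G x y ≡ true → Q y ≡ true) →
                     deg G x ≡ count (λ y → Q y ∧ adj G x y)
  deg≡count-within {Q} {x} nbrs⊆Q = trans (deg≡count x) (count-cong pointwise)
    where
    pointwise : ∀ y → adj G x y ≡ (Q y ∧ adj G x y)
    pointwise y with adj G x y in Exy
    ... | false = sym (∧-zeroʳ (Q y))
    ... | true  rewrite nbrs⊆Q Exy = refl

  sumOn-deg-comm : ∀ {P Q : Fin n → Bool} → (∀ {x y} → P x ≡ true → adj G x y ≡ true → Q y ≡ true) →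
                   sumOn P (deg G) ≡ sumOn Q (λ y → count (λ x → P x ∧ adj G y x))
  sumOn-deg-comm {P} {Q} nbrs⊆Q =
    trans (sumOn-cong P λ x Px → deg≡count-within (nbrs⊆Q Px)) (sumOn-count-comm P Q (adj G) (Graph.sym G))

  maximum-independent-dominating : ∀ {α} {P : Fin n → Bool} → (∀ S → IsIndependent G S → ∣ S ∣ ≤ α) →
                                   count P ≡ α → IsIndependentᵇ P →
                                   ∀ {y} → P y ≡ false → ∃[ x ] P x ≡ true × adj G x y ≡ true
  maximum-independent-dominating {α} {P} α-max count≡α independent {y} Py
    with any? (λ x → (P x ≟ᴮ true) ×-dec (adj G x y ≟ᴮ true))
  ... | yes dominated = dominated
  ... | no undominated = ⊥-elim (1+n≰n (begin
    suc α                     ≡⟨ cong suc count≡α ⟨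
    suc (count P)             ≤⟨ count-insert (insert-⊇ P y) Py (insert-new P y) ⟩
    count (insert P y)        ≡⟨ ∣tabulate∣≡count (insert P y) ⟨
    ∣ tabulate (insert P y) ∣ ≤⟨ α-max _ (IsIndependent-tabulate independent′) ⟩
    α                         ∎))
    where
    open ≤-Reasoning
    non-adjacent : ∀ {x} → P x ≡ true → adj G x y ≡ false
    non-adjacent {x} Px with adj G x y in Exy
    ... | false = refl
    ... | true  = ⊥-elim (undominated (x , Px , Exy))
    independent′ : IsIndependentᵇ (insert P y)
    independent′ {x} {x′} P′x P′x′ with insert-cases P y P′x | insert-cases P y P′x′
    ... | inj₁ Px  | inj₁ Px′  = independent Px Px′
    ... | inj₁ Px  | inj₂ refl = non-adjacent Px
    ... | inj₂ refl | inj₁ Px′ = trans (Graph.sym G y x′) (non-adjacent Px′)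
    ... | inj₂ refl | inj₂ refl = irrefl G y

  module DegreeBound {δ Δ} (δ≤deg : ∀ v → δ ≤ deg G v) (deg≤Δ : ∀ v → deg G v ≤ Δ) (δ≤Δ : δ ≤ Δ)
                     {I : Fin n → Bool} (independent : IsIndependentᵇ I)
                     {C : Fin n → Bool} (cover : König.IsCover I (adj G) C) where

    L R K : Fin n → Bool
    L v = I v ∧ not (C v)
    R v = C v ∧ not (I v)
    K v = C v ∧ I v

    L-nbrs⊆R : ∀ {x y} → L x ≡ true → adj G x y ≡ true → R y ≡ true
    L-nbrs⊆R {x} {y} Lx Exy with I y in Iy
    ... | true  with () ← trans (sym Exy) (independent (∧-conicalˡ (I x) _ Lx) Iy)
    ... | false with cover (∧-conicalˡ (I x) _ Lx) Iy Exy
    ...   | inj₂ Cy rewrite Cy = refl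
    ...   | inj₁ Cx with () ← trans (sym Cx) (not-injective (∧-conicalʳ (I x) _ Lx))

    common-nbrs≤deg : ∀ y → count (λ x → L x ∧ adj G y x) ≤ deg G y
    common-nbrs≤deg y = ≤-trans (count-mono (λ x → ∧-conicalʳ (L x) _)) (≤-reflexive (sym (deg≡count y)))

    s₀≤s₁ : δ * count L ≤ sumOn L (deg G)
    s₀≤s₁ = ≤-trans (≤-reflexive (sym (sumOn-const L δ))) (sumOn-mono-≤ L (λ x _ → δ≤deg x))

    s₁≡s₂ : sumOn L (deg G) ≡ sumOn R (λ y → count (λ x → L x ∧ adj G y x))
    s₁≡s₂ = sumOn-deg-comm L-nbrs⊆R

    s₂≤s₃ : sumOn R (λ y → count (λ x → L x ∧ adj G y x)) ≤ sumOn R (deg G)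
    s₂≤s₃ = sumOn-mono-≤ R (λ y _ → common-nbrs≤deg y)

    s₃≤s₄ : sumOn R (deg G) ≤ Δ * count R
    s₃≤s₄ = ≤-trans (sumOn-mono-≤ R (λ y _ → deg≤Δ y)) (≤-reflexive (sumOn-const R Δ))

    δ∣L∣≤Δ∣R∣ : δ * count L ≤ Δ * count R
    δ∣L∣≤Δ∣R∣ = ≤-trans s₀≤s₁ (≤-trans (≤-reflexive s₁≡s₂) (≤-trans s₂≤s₃ s₃≤s₄))

    δ∣I∣≡δ∣K∣+δ∣L∣ : δ * count I ≡ δ * count K + δ * count L
    δ∣I∣≡δ∣K∣+δ∣L∣ = trans (cong (δ *_) ∣I∣≡∣K∣+∣L∣) (*-distribˡ-+ δ (count K) (count L))
      where
      ∣I∣≡∣K∣+∣L∣ = trans (count-split I C) (cong (_+ count L) (count-cong λ v → ∧-comm (I v) (C v)))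

    Δ∣C∣≡Δ∣K∣+Δ∣R∣ : Δ * count C ≡ Δ * count K + Δ * count R
    Δ∣C∣≡Δ∣K∣+Δ∣R∣ = trans (cong (Δ *_) (count-split C I)) (*-distribˡ-+ Δ (count K) (count R))

    δ∣I∣≤Δ∣C∣ : δ * count I ≤ Δ * count C
    δ∣I∣≤Δ∣C∣ = begin
      δ * count I                 ≡⟨ δ∣I∣≡δ∣K∣+δ∣L∣ ⟩
      δ * count K + δ * count L   ≤⟨ +-mono-≤ (*-monoˡ-≤ (count K) δ≤Δ) δ∣L∣≤Δ∣R∣ ⟩
      Δ * count K + Δ * count R   ≡⟨ Δ∣C∣≡Δ∣K∣+Δ∣R∣ ⟨
      Δ * count C                 ∎
      where open ≤-Reasoning

    module Tight (δ<Δ : δ < Δ) (tight : δ * count I ≡ Δ * count C) where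

      private
        parts : δ * count K ≡ Δ * count K × δ * count L ≡ Δ * count R
        parts = +-mono-≤-≡ (*-monoˡ-≤ (count K) δ≤Δ) δ∣L∣≤Δ∣R∣
                  (trans (sym δ∣I∣≡δ∣K∣+δ∣L∣) (trans tight Δ∣C∣≡Δ∣K∣+Δ∣R∣))
        squeezed = ≤-squeeze (≤-trans s₀≤s₁ (≤-reflexive s₁≡s₂)) s₂≤s₃ s₃≤s₄ (proj₂ parts)
        s₀≡s₁ : δ * count L ≡ sumOn L (deg G)
        s₀≡s₁ = trans (proj₁ squeezed) (sym s₁≡s₂)
        s₂≡s₃ : sumOn R (λ y → count (λ x → L x ∧ adj G y x)) ≡ sumOn R (deg G)
        s₂≡s₃ = proj₁ (proj₂ squeezed)
        s₃≡s₄ : sumOn R (deg G) ≡ Δ * count R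
        s₃≡s₄ = proj₂ (proj₂ squeezed)

      I⊆L : ∀ {x} → I x ≡ true → L x ≡ true
      I⊆L {x} Ix with C x in Cx
      ... | false rewrite Ix = refl
      ... | true with () ← trans (sym (cong₂ _∧_ Cx Ix)) (count-≡0 K (m<n∧m*k≡n*k⇒k≡0 δ<Δ (proj₁ parts)) x)

      deg-L : ∀ {x} → L x ≡ true → deg G x ≡ δ
      deg-L {x} Lx = sym (sumOn-mono-≤-≡ L (λ x _ → δ≤deg x) (trans (sumOn-const L δ) s₀≡s₁) x Lx)

      R-nbrs⊆L : ∀ {y x} → R y ≡ true → adj G y x ≡ true → L x ≡ true
      R-nbrs⊆L {y} {x} Ry Eyx = ∧-conicalˡ (L x) _ (count-mono-≡ (λ x → ∧-conicalʳ (L x) _) all-nbrs-in-L x Eyx)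
        where
        all-nbrs-in-L : count (λ x → L x ∧ adj G y x) ≡ count (adj G y)
        all-nbrs-in-L = trans (sumOn-mono-≤-≡ R (λ y _ → common-nbrs≤deg y) s₂≡s₃ y Ry) (deg≡count y)

      deg-R : ∀ {y} → R y ≡ true → deg G y ≡ Δ
      deg-R {y} Ry = sumOn-mono-≤-≡ R (λ y _ → deg≤Δ y) (trans s₃≡s₄ (sym (sumOn-const R Δ))) y Ry

  ProperColouring : (Fin n → Bool) → Set
  ProperColouring side = ∀ i j → adj G i j ≡ true → side i ≡ side j → ⊥

  length≤count-side : ∀ {side} → ProperColouring side → ∀ {M} → IsMatching G M → length M ≤ count (not ∘ side)
  length≤count-side {side} proper {M} (edges , unique) = begin
    length M           ≡⟨ length-map falseEnd M ⟨
    length (map falseEnd M) ≤⟨ length≤count (not ∘ side) (Unique-map-endpoint falseEnd endpoint unique)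
                                                         (map⁺ (All.map falseEnd-false edges)) ⟩
    count (not ∘ side) ∎
    where
    open ≤-Reasoning
    falseEnd : Fin n × Fin n → Fin n
    falseEnd (a , b) = if side a then b else a
    endpoint : ∀ a b → falseEnd (a , b) ≡ a ⊎ falseEnd (a , b) ≡ b
    endpoint a b with side a
    ... | true  = inj₂ refl
    ... | false = inj₁ refl
    falseEnd-false : ∀ {e} → adj G (proj₁ e) (proj₂ e) ≡ true → not (side (falseEnd e)) ≡ true
    falseEnd-false {a , b} Eab with side a in sa | side b in sb
    ... | false | _     = cong not sa
    ... | true  | false = cong not sb
    ... | true  | true  = ⊥-elim (proper a b Eab (trans sa (sym sb)))

  bipartite-regular-count : ∀ {δ Δ} ((side , _) : IsBipartiteRegular G δ Δ) → δ * count side ≡ Δ * count (not ∘ side)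
  bipartite-regular-count {δ} {Δ} (side , proper , deg-A , deg-B) = begin
    δ * count side                                  ≡⟨ sumOn-const side δ ⟨
    sumOn side (const δ)                            ≡⟨ sumOn-cong side (λ x Ax → sym (deg-A x Ax)) ⟩
    sumOn side (deg G)                              ≡⟨ sumOn-deg-comm A-nbrs⊆B ⟩
    sumOn B (λ y → count (λ x → side x ∧ adj G y x))
      ≡⟨ sumOn-cong B (λ y By → sym (deg≡count-within (B-nbrs⊆A By))) ⟩
    sumOn B (deg G)                                 ≡⟨ sumOn-cong B (λ y By → deg-B y (not-injective By)) ⟩
    sumOn B (const Δ)                               ≡⟨ sumOn-const B Δ ⟩
    Δ * count B                                     ∎
    where
    open ≡-Reasoning
    B = not ∘ side
    A-nbrs⊆B : ∀ {x y} → side x ≡ true → adj G x y ≡ true → B y ≡ true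
    A-nbrs⊆B {x} {y} Ax Exy with side y in Ay
    ... | false = refl
    ... | true  = ⊥-elim (proper x y Exy (trans Ax (sym Ay)))
    B-nbrs⊆A : ∀ {y x} → B y ≡ true → adj G y x ≡ true → side x ≡ true
    B-nbrs⊆A {y} {x} By Eyx with side x in Ax
    ... | true  = refl
    ... | false = ⊥-elim (proper y x Eyx (trans (not-injective By) (sym Ax)))

module _ {n} (G : Graph n) {δ Δ α μ : ℕ} (min-deg : IsMinDegree G δ) (max-deg : IsMaxDegree G Δ)
         (α-is : IsIndependenceNumber G α) (μ-is : IsMatchingNumber G μ) where

  private
    S : Subset n
    S = proj₁ (proj₁ α-is)

    I : Fin n → Bool
    I = lookup S

    I-independent : IsIndependentᵇ G I
    I-independent = IsIndependent-lookup G (proj₁ (proj₂ (proj₁ α-is)))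

    count-I : count I ≡ α
    count-I = trans (sym (∣tabulate∣≡count I)) (trans (cong ∣_∣ (tabulate∘lookup S)) (proj₂ (proj₂ (proj₁ α-is))))

    α-max : ∀ T → IsIndependent G T → ∣ T ∣ ≤ α
    α-max = proj₂ α-is

    δ≤Δ : δ ≤ Δ
    δ≤Δ = let v , _ = proj₁ min-deg in ≤-trans (proj₂ min-deg v) (proj₂ max-deg v)

    module Cut = König I (adj G)

    module WithCover {r} (r-matching : Cut.IsMatchingMap r) {C} (cover : Cut.IsCover C)
                     (∣C∣≤size : count C ≤ Cut.size r) where

      open DegreeBound G (proj₂ min-deg) (proj₂ max-deg) δ≤Δ I-independent cover public

      size≤μ : Cut.size r ≤ μ
      size≤μ = subst (_≤ μ) (length-mateList id r) (proj₂ μ-is (mateList id r) (Cut.mateList-isMatching r-matching))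

      Δ∣C∣≤Δμ : Δ * count C ≤ Δ * μ
      Δ∣C∣≤Δμ = *-monoʳ-≤ Δ (≤-trans ∣C∣≤size size≤μ)

      δα≤Δμ : δ * α ≤ Δ * μ
      δα≤Δμ = subst (λ a → δ * a ≤ Δ * μ) count-I (≤-trans δ∣I∣≤Δ∣C∣ Δ∣C∣≤Δμ)

      δα≡Δμ⇒bipartite-regular : δ < Δ → δ * α ≡ Δ * μ → IsBipartiteRegular G δ Δ
      δα≡Δμ⇒bipartite-regular δ<Δ δα≡Δμ =
        I , proper , (λ x Ix → deg-L (I⊆L Ix)) , (λ y Iy → deg-R (outside⊆R Iy))
        where
        δ∣I∣≡δα : δ * count I ≡ δ * α
        δ∣I∣≡δα = cong (δ *_) count-I
        open Tight δ<Δ (≤-antisym δ∣I∣≤Δ∣C∣ (≤-trans Δ∣C∣≤Δμ (≤-reflexive (trans (sym δα≡Δμ) (sym δ∣I∣≡δα)))))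
        outside⊆R : ∀ {y} → I y ≡ false → R y ≡ true
        outside⊆R Iy = let _ , Ix , Exy = maximum-independent-dominating G α-max count-I I-independent Iy in
                       L-nbrs⊆R (I⊆L Ix) Exy
        proper : ∀ i j → adj G i j ≡ true → I i ≡ I j → ⊥
        proper i j Eij Ii≡Ij with I i in Ii
        ... | true  with () ← trans (sym Eij) (I-independent Ii (sym Ii≡Ij))
        ... | false with () ← trans (sym (∧-conicalˡ (I j) _ (R-nbrs⊆L (outside⊆R Ii) Eij))) (sym Ii≡Ij)

  δα≤Δμ : δ * α ≤ Δ * μ
  δα≤Δμ = let _ , r-matching , _ , cover , ∣C∣≤size = Cut.matching-and-cover in
          WithCover.δα≤Δμ r-matching cover ∣C∣≤size

  δα≡Δμ⇒bipartite-regular : δ < Δ → δ * α ≡ Δ * μ → IsBipartiteRegular G δ Δ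
  δα≡Δμ⇒bipartite-regular = let _ , r-matching , _ , cover , ∣C∣≤size = Cut.matching-and-cover in
                            WithCover.δα≡Δμ⇒bipartite-regular r-matching cover ∣C∣≤size

  bipartite-regular⇒δα≡Δμ : IsBipartiteRegular G δ Δ → δ * α ≡ Δ * μ
  bipartite-regular⇒δα≡Δμ bipartite@(side , proper , _) = ≤-antisym δα≤Δμ (begin
    Δ * μ                  ≤⟨ *-monoʳ-≤ Δ μ≤∣B∣ ⟩
    Δ * count (not ∘ side) ≡⟨ bipartite-regular-count G bipartite ⟨
    δ * count side         ≤⟨ *-monoʳ-≤ δ ∣A∣≤α ⟩
    δ * α                  ∎)
    where
    open ≤-Reasoning
    μ≤∣B∣ : μ ≤ count (not ∘ side)
    μ≤∣B∣ = let M , matching , length≡μ = proj₁ μ-is in subst (_≤ _) length≡μ (length≤count-side G proper matching)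
    A-independent : IsIndependentᵇ G side
    A-independent {x} {y} Ax Ay with adj G x y in Exy
    ... | false = refl
    ... | true  = ⊥-elim (proper x y Exy (trans Ax (sym Ay)))
    ∣A∣≤α : count side ≤ α
    ∣A∣≤α = subst (_≤ α) (∣tabulate∣≡count side) (α-max (tabulate side) (IsIndependent-tabulate G A-independent))

theorem1 : ∀ {n} (G : Graph n) (δ Δ α μ : ℕ) →
    IsMinDegree G δ → IsMaxDegree G Δ →
    IsIndependenceNumber G α → IsMatchingNumber G μ →
    (δ * α ≤ Δ * μ) × (δ < Δ → ((δ * α ≡ Δ * μ) ⇔ IsBipartiteRegular G δ Δ))
theorem1 G δ Δ α μ min-deg max-deg α-is μ-is =
  δα≤Δμ G min-deg max-deg α-is μ-is ,
  λ δ<Δ → mk⇔ (δα≡Δμ⇒bipartite-regular G min-deg max-deg α-is μ-is δ<Δ)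
              (bipartite-regular⇒δα≡Δμ G min-deg max-deg α-is μ-is)
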